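{- Let $G$ be a finite connected even graph, let $\mathcal{C}$ be a cycle decomposition of $G$, and let $CI(G)$ be the cycle intersection graph of $G$ with respect to $\mathcal{C}$. If $CI(G)$ is a star with $|E(CI(G))|=n$, then $\nabla(G)=n$.
   Context: An even graph is a graph in which every vertex has even degree (multiple edges are allowed). A cycle decomposition of $G$ is a collection of cycles of $G$ whose edge sets partition $E(G)$. The cycle intersection graph $CI(G)$ with respect to $\mathcal{C}$ is the (multi)graph with vertex set $\mathcal{C}$ having, for each pair of distinct cycles $C,C'\in\mathcal{C}$ and each vertex $v\in V(C)\cap V(C')$, one edge joining $C$ and $C'$. A decycling set of $G$ is a set $S\subseteq V(G)$ with $G\setminus S$ acyclic; $\nabla(G)$ is the minimum size of a decycling set. -}

module Defs where

open import Data.Nat using (ℕ; zero; suc; _<_; _≤_; _+_)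
open import Data.Nat.Divisibility using (_∣_)
open import Data.Nat.DivMod using (_mod_)
open import Data.Fin using (Fin; toℕ; _≟_)
open import Data.Fin.Properties using (any?)
open import Data.Fin.Subset using (Subset; _∈_; _∉_; ∣_∣)
open import Data.List using (List; length; filter; map)
open import Data.Nat.ListAction using (sum)
open import Data.List.Base using (allFin)
open import Data.Product using (Σ; ∃; ∃-syntax; _×_; _,_)
open import Data.Sum using (_⊎_)
open import Data.Bool using (if_then_else_)
open import Relation.Binary.PropositionalEquality using (_≡_; _≢_)
open import Relation.Nullary using (¬_; does)
open import Relation.Nullary.Decidable using (_×-dec_)
open import Function.Definitions using (Injective)

record Multigraph : Set where
  field
    nV nE : ℕ
    src tgt : Fin nE → Fin nV
    loopless : ∀ e → src e ≢ tgt e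
open Multigraph public

Joins : (G : Multigraph) → Fin (nE G) → Fin (nV G) → Fin (nV G) → Set
Joins G e u w = (src G e ≡ u × tgt G e ≡ w) ⊎ (src G e ≡ w × tgt G e ≡ u)

degree : (G : Multigraph) → Fin (nV G) → ℕ
degree G v = length (filter (λ e → src G e ≟ v) (allFin (nE G)))
           + length (filter (λ e → tgt G e ≟ v) (allFin (nE G)))

Even : Multigraph → Set
Even G = ∀ v → 2 ∣ degree G v

data Walk (G : Multigraph) : Fin (nV G) → Fin (nV G) → Set where
  [] : ∀ {v} → Walk G v v
  step : ∀ {u w v} (e : Fin (nE G)) → Joins G e u w → Walk G w v → Walk G u v

Connected : Multigraph → Set
Connected G = ∀ u v → Walk G u v

next : ∀ {k} → Fin (suc k) → Fin (suc k)
next {k} i = suc (toℕ i) mod (suc k)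

-- A cycle of G of length len + 2: distinct vertices vs 0 .. vs (len+1),
-- distinct edges es 0 .. es (len+1), edge es i joining vs i and vs (i+1 mod).
record Cycle (G : Multigraph) : Set where
  field
    len : ℕ
    vs : Fin (suc (suc len)) → Fin (nV G)
    es : Fin (suc (suc len)) → Fin (nE G)
    vs-inj : Injective _≡_ _≡_ vs
    es-inj : Injective _≡_ _≡_ es
    joins : ∀ i → Joins G (es i) (vs i) (vs (next i))
open Cycle public

_∈V_ : ∀ {G} → Fin (nV G) → Cycle G → Set
v ∈V C = ∃[ i ] vs C i ≡ v

_∈E_ : ∀ {G} → Fin (nE G) → Cycle G → Set
e ∈E C = ∃[ i ] es C i ≡ e

record CycleDecomposition (G : Multigraph) : Set where
  field
    c : ℕ
    cyc : Fin c → Cycle G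
    covers : ∀ e → ∃[ i ] (e ∈E cyc i)
    disjoint : ∀ e i j → e ∈E cyc i → e ∈E cyc j → i ≡ j
open CycleDecomposition public

-- Cycle intersection graph CI(G) w.r.t. a decomposition 𝒞, as a multigraph
-- on vertex set Fin c given by edge multiplicities: for i ≢ j the number of
-- edges joining C_i and C_j is |V(C_i) ∩ V(C_j)|.
CImult : ∀ {G} (𝒞 : CycleDecomposition G) → Fin (c 𝒞) → Fin (c 𝒞) → ℕ
CImult {G} 𝒞 i j =
  length (filter (λ v → any? (λ t → vs (cyc 𝒞 i) t ≟ v)
                        ×-dec any? (λ t → vs (cyc 𝒞 j) t ≟ v))
                 (allFin (nV G)))

CIedges : ∀ {G} (𝒞 : CycleDecomposition G) → ℕ
CIedges 𝒞 = sum (map (λ i → sum (map (λ j →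
                 if does (toℕ i Data.Nat.<? toℕ j) then CImult 𝒞 i j else 0)
               (allFin (c 𝒞)))) (allFin (c 𝒞)))

IsStar : (m : ℕ) → (Fin m → Fin m → ℕ) → Set
IsStar m mult = 2 ≤ m × Σ (Fin m) λ z →
    (∀ j → j ≢ z → mult z j ≡ 1)
  × (∀ j k → j ≢ z → k ≢ z → j ≢ k → mult j k ≡ 0)

-- S is a decycling set: G \ S is acyclic, i.e. every cycle of G
-- meets S (the cycles of G \ S are exactly the cycles of G avoiding S).
Decycling : (G : Multigraph) → Subset (nV G) → Set
Decycling G S = ∀ (C : Cycle G) → ∃[ i ] (vs C i ∈ S)

DecyclingNumber : Multigraph → ℕ → Set
DecyclingNumber G n =
  (∃[ S ] (Decycling G S × ∣ S ∣ ≡ n)) × (∀ S → Decycling G S → n ≤ ∣ S ∣)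

-- Each other cycle of the decomposition meets
-- the central cycle in exactly one vertex (its attachment vertex) and meets no
-- further cycle. A cycle of G that avoids all n attachment vertices can never
-- pass from one decomposition cycle to another, so all its edges lie in a single
-- decomposition cycle, whence it runs through every vertex of that cycle, and in
-- particular through an attachment vertex. So the attachment vertices form a
-- decycling set. Conversely the n non-central cycles are pairwise
-- vertex-disjoint cycles of G, so every decycling set has at least n vertices.
module Submission where

open import Defs
open import Level using (0ℓ)
open import Function using (_∘_; id)
open import Function.Definitions using (Injective)
open import Data.Bool using (if_then_else_)
open import Data.Empty using (⊥-elim)
open import Data.Nat using (ℕ; zero; suc; pred; _+_; _≤_; _<_; _<?_; _∸_; _%_; z≤n; s≤s; s≤s⁻¹)
open import Data.Nat.Properties
  using (+-0-commutativeMonoid; ≤-trans; ≤-reflexive; ≤-antisym; <-≤-trans; <-irrefl; <-asym; ≮⇒≥; ≤∧≢⇒<;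
         +-identityʳ; +-suc; module ≤-Reasoning; +-monoʳ-≤; n≤1+n; m<m+n; m+[n∸m]≡n; m≤n⇒m<n∨m≡n; suc-injective; 1+n≢n)
open import Data.Nat.DivMod using (m<n⇒m%n≡m; n%n≡0)
open import Data.Nat.ListAction using (sum)
open import Data.Fin using (Fin; zero; suc; toℕ; fromℕ; inject₁; punchIn; punchOut; _≟_)
open import Data.Fin.Properties
  using (toℕ-injective; toℕ-fromℕ<; toℕ-fromℕ; toℕ-inject₁; toℕ<n; any?; punchIn-injective; punchInᵢ≢i; punchIn-punchOut)
import Data.Fin.Properties as Fin
open import Data.Fin.Subset using (Subset; _∈_; _∉_; ∣_∣; ⁅_⁆; _∪_; _-_; inside; outside) renaming (⊥ to ∅)
open import Data.Fin.Subset.Properties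
  using (_∈?_; x∈⁅x⁆; x∈p∪q⁺; x∈p∧x≢y⇒x∈p-y; x∈p⇒∣p-x∣<∣p∣; ∣⁅x⁆∣≡1; ∣⊥∣≡0)
open import Data.List using ([]; _∷_; length; filter; map; tabulate; allFin)
open import Data.List.Properties using (map-tabulate; filter-≐)
open import Data.List.Membership.Propositional using () renaming (_∈_ to _∈ˡ_)
open import Data.List.Membership.Propositional.Properties using (∈-filter⁺; ∈-filter⁻; ∈-allFin)
open import Data.List.Relation.Unary.Any using (here)
open import Data.Product using (∃; ∃-syntax; _×_; _,_; proj₁; proj₂; swap)
open import Data.Sum using (_⊎_; inj₁; inj₂)
open import Data.Vec using (_∷_; [])
open import Relation.Binary.PropositionalEquality
open import Relation.Nullary using (¬_; Dec; yes; no; does)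
open import Relation.Nullary.Decidable using (_×-dec_)
open import Relation.Unary using (Pred; Decidable)
open import Algebra.Properties.CommutativeMonoid.Sum +-0-commutativeMonoid
  using (sum-remove; ∑-distrib-+; sum-cong-≗; sum-replicate-zero) renaming (sum to ∑)

module _ {A : Set} {P : Pred A 0ℓ} (P? : Decidable P) where

  length-filter≡0⇒∄ : ∀ {xs x} → length (filter P? xs) ≡ 0 → x ∈ˡ xs → ¬ P x
  length-filter≡0⇒∄ {xs} eq x∈xs px with filter P? xs | ∈-filter⁺ P? x∈xs px
  ... | [] | ()
  ... | _ ∷ _ | _ with () ← eq

  length-filter≡1⇒∃ : ∀ xs → length (filter P? xs) ≡ 1 → ∃ P
  length-filter≡1⇒∃ xs eq with filter P? xs in ys≡
  ... | y ∷ [] = y , proj₂ (∈-filter⁻ P? {xs = xs} (subst (y ∈ˡ_) (sym ys≡) (here refl)))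

  length-filter≡1⇒unique : ∀ {xs x y} → length (filter P? xs) ≡ 1 →
                           x ∈ˡ xs → y ∈ˡ xs → P x → P y → x ≡ y
  length-filter≡1⇒unique {xs} eq x∈xs y∈xs px py
    with filter P? xs | ∈-filter⁺ P? x∈xs px | ∈-filter⁺ P? y∈xs py
  ... | _ ∷ [] | here refl | here refl = refl
  ... | _ ∷ _ ∷ _ | _ | _ with () ← eq

sum-tabulate : ∀ {n} (f : Fin n → ℕ) → sum (tabulate f) ≡ ∑ f
sum-tabulate {zero}  f = refl
sum-tabulate {suc n} f = cong (f zero +_) (sum-tabulate (f ∘ suc))

sum-map-allFin : ∀ {n} (f : Fin n → ℕ) → sum (map f (allFin n)) ≡ ∑ f
sum-map-allFin f = trans (cong sum (map-tabulate id f)) (sum-tabulate f)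

∑-const-1 : ∀ n → ∑ {n} (λ _ → 1) ≡ n
∑-const-1 zero    = refl
∑-const-1 (suc n) = cong suc (∑-const-1 n)

module _ {P : Set} where

  if-does-cong : ∀ (P? : Dec P) {x y} → (P → x ≡ y) →
                 (if does P? then x else 0) ≡ (if does P? then y else 0)
  if-does-cong (yes p) eq = eq p
  if-does-cong (no _)  eq = refl

  if-does-0 : ∀ (P? : Dec P) {x} → (P → x ≡ 0) → (if does P? then x else 0) ≡ 0
  if-does-0 (yes p) eq = eq p
  if-does-0 (no _)  eq = refl

  if-does-xor : ∀ {Q : Set} (P? : Dec P) (Q? : Dec Q) → (P → ¬ Q) → (¬ P → Q) →
                (if does P? then 1 else 0) + (if does Q? then 1 else 0) ≡ 1
  if-does-xor (yes p) (yes q) P⇒¬Q ¬P⇒Q = ⊥-elim (P⇒¬Q p q)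
  if-does-xor (yes _) (no _)  P⇒¬Q ¬P⇒Q = refl
  if-does-xor (no _)  (yes _) P⇒¬Q ¬P⇒Q = refl
  if-does-xor (no ¬p) (no ¬q) P⇒¬Q ¬P⇒Q = ⊥-elim (¬q (¬P⇒Q ¬p))

module _ {m : ℕ} where

  upper : (Fin m → Fin m → ℕ) → Fin m → Fin m → ℕ
  upper mult i j = if does (toℕ i <? toℕ j) then mult i j else 0

  [_≺_] : Fin m → Fin m → ℕ
  [ i ≺ j ] = upper (λ _ _ → 1) i j

  upper-cong : ∀ mult mult′ i j → (toℕ i < toℕ j → mult i j ≡ mult′ i j) →
               upper mult i j ≡ upper mult′ i j
  upper-cong _ _ i j = if-does-cong (toℕ i <? toℕ j)

  upper-irrefl : ∀ mult i → upper mult i i ≡ 0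
  upper-irrefl mult i = if-does-0 (toℕ i <? toℕ i) (λ i<i → ⊥-elim (<-irrefl refl i<i))

  [≺]+[≻]≡1 : ∀ {i j} → i ≢ j → [ i ≺ j ] + [ j ≺ i ] ≡ 1
  [≺]+[≻]≡1 {i} {j} i≢j = if-does-xor (toℕ i <? toℕ j) (toℕ j <? toℕ i) <-asym
    (λ i≮j → ≤∧≢⇒< (≮⇒≥ i≮j) (i≢j ∘ toℕ-injective ∘ sym))

-- CIedges 𝒞 is edgeCount (c 𝒞) (CImult 𝒞) by definition.
edgeCount : ∀ m → (Fin m → Fin m → ℕ) → ℕ
edgeCount m mult = sum (map (λ i → sum (map (upper mult i) (allFin m))) (allFin m))

edgeCount-star : ∀ {m} {mult : Fin m → Fin m → ℕ} → (∀ i j → mult i j ≡ mult j i) →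
                 IsStar m mult → edgeCount m mult ≡ pred m
edgeCount-star {suc k} {mult} mult-sym (_ , z , spoke , no-edge) = begin
  edgeCount (suc k) mult
    ≡⟨ trans (sum-map-allFin (λ i → sum (map (upper mult i) (allFin (suc k)))))
             (sum-cong-≗ (λ i → sum-map-allFin (upper mult i))) ⟩
  ∑ (λ i → ∑ (upper mult i))
    ≡⟨ sum-remove {i = z} (λ i → ∑ (upper mult i)) ⟩
  ∑ (upper mult z) + ∑ (λ l → ∑ (upper mult (leaf l)))
    ≡⟨ cong₂ _+_ centre-row (sum-cong-≗ (λ l → leaf-row (leaf l) (punchInᵢ≢i z l))) ⟩
  ∑ (λ l → [ z ≺ leaf l ]) + ∑ (λ l → [ leaf l ≺ z ])
    ≡⟨ sym (∑-distrib-+ (λ l → [ z ≺ leaf l ]) (λ l → [ leaf l ≺ z ])) ⟩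
  ∑ (λ l → [ z ≺ leaf l ] + [ leaf l ≺ z ])
    ≡⟨ sum-cong-≗ {k} (λ l → [≺]+[≻]≡1 (punchInᵢ≢i z l ∘ sym)) ⟩
  ∑ {k} (λ _ → 1)
    ≡⟨ ∑-const-1 k ⟩
  k ∎
  where
  open ≡-Reasoning

  leaf : Fin k → Fin (suc k)
  leaf = punchIn z

  centre-row : ∑ (upper mult z) ≡ ∑ (λ l → [ z ≺ leaf l ])
  centre-row = trans (sum-remove {i = z} (upper mult z))
    (cong₂ _+_ (upper-irrefl mult z)
               (sum-cong-≗ (λ l → upper-cong mult _ z (leaf l) (λ _ → spoke (leaf l) (punchInᵢ≢i z l)))))

  leaf-row : ∀ i → i ≢ z → ∑ (upper mult i) ≡ [ i ≺ z ]
  leaf-row i i≢z = begin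
    ∑ (upper mult i)                          ≡⟨ sum-remove {i = z} (upper mult i) ⟩
    upper mult i z + ∑ (upper mult i ∘ leaf)  ≡⟨ cong₂ _+_ to-centre (sum-cong-≗ between-leaves) ⟩
    [ i ≺ z ] + ∑ {k} (λ _ → 0)               ≡⟨ cong ([ i ≺ z ] +_) (sum-replicate-zero k) ⟩
    [ i ≺ z ] + 0                             ≡⟨ +-identityʳ _ ⟩
    [ i ≺ z ]                                 ∎
    where
    to-centre : upper mult i z ≡ [ i ≺ z ]
    to-centre = upper-cong mult _ i z (λ _ → trans (mult-sym i z) (spoke i i≢z))
    between-leaves : ∀ l → upper mult i (leaf l) ≡ 0
    between-leaves l = if-does-0 (toℕ i <? toℕ (leaf l))
      (λ i<l → no-edge i (leaf l) i≢z (punchInᵢ≢i z l) (λ i≡l → <-irrefl (cong toℕ i≡l) i<l))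

∣p∪q∣≤∣p∣+∣q∣ : ∀ {n} (p q : Subset n) → ∣ p ∪ q ∣ ≤ ∣ p ∣ + ∣ q ∣
∣p∪q∣≤∣p∣+∣q∣ []            []            = z≤n
∣p∪q∣≤∣p∣+∣q∣ (outside ∷ p) (outside ∷ q) = ∣p∪q∣≤∣p∣+∣q∣ p q
∣p∪q∣≤∣p∣+∣q∣ (outside ∷ p) (inside  ∷ q) =
  ≤-trans (s≤s (∣p∪q∣≤∣p∣+∣q∣ p q)) (≤-reflexive (sym (+-suc _ _)))
∣p∪q∣≤∣p∣+∣q∣ (inside  ∷ p) (outside ∷ q) = s≤s (∣p∪q∣≤∣p∣+∣q∣ p q)
∣p∪q∣≤∣p∣+∣q∣ (inside  ∷ p) (inside  ∷ q) =
  s≤s (≤-trans (∣p∪q∣≤∣p∣+∣q∣ p q) (+-monoʳ-≤ ∣ p ∣ (n≤1+n _)))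

image : ∀ {k n} → (Fin k → Fin n) → Subset n
image {zero}  f = ∅
image {suc k} f = ⁅ f zero ⁆ ∪ image (f ∘ suc)

∈-image : ∀ {k n} (f : Fin k → Fin n) i → f i ∈ image f
∈-image f zero    = x∈p∪q⁺ (inj₁ (x∈⁅x⁆ (f zero)))
∈-image f (suc i) = x∈p∪q⁺ (inj₂ (∈-image (f ∘ suc) i))

∣image∣≤ : ∀ {k n} (f : Fin k → Fin n) → ∣ image f ∣ ≤ k
∣image∣≤ {zero}  {n} f = ≤-reflexive (∣⊥∣≡0 n)
∣image∣≤ {suc k}     f = begin
  ∣ ⁅ f zero ⁆ ∪ image (f ∘ suc) ∣     ≤⟨ ∣p∪q∣≤∣p∣+∣q∣ ⁅ f zero ⁆ (image (f ∘ suc)) ⟩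
  ∣ ⁅ f zero ⁆ ∣ + ∣ image (f ∘ suc) ∣ ≡⟨ cong (_+ ∣ image (f ∘ suc) ∣) (∣⁅x⁆∣≡1 (f zero)) ⟩
  suc ∣ image (f ∘ suc) ∣              ≤⟨ s≤s (∣image∣≤ (f ∘ suc)) ⟩
  suc k                                ∎
  where open ≤-Reasoning

injection⇒≤∣∣ : ∀ {k n} (S : Subset n) (f : Fin k → Fin n) →
                Injective _≡_ _≡_ f → (∀ i → f i ∈ S) → k ≤ ∣ S ∣
injection⇒≤∣∣ {zero}  S f f-inj f∈S = z≤n
injection⇒≤∣∣ {suc k} S f f-inj f∈S = begin
  suc k                ≤⟨ s≤s (injection⇒≤∣∣ (S - f zero) (f ∘ suc) (Fin.suc-injective ∘ f-inj) f∘suc∈S-f₀) ⟩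
  suc ∣ S - f zero ∣   ≤⟨ x∈p⇒∣p-x∣<∣p∣ (f∈S zero) ⟩
  ∣ S ∣                ∎
  where
  open ≤-Reasoning
  f∘suc∈S-f₀ : ∀ i → f (suc i) ∈ S - f zero
  f∘suc∈S-f₀ i = x∈p∧x≢y⇒x∈p-y (f∈S (suc i)) (Fin.0≢1+n ∘ sym ∘ f-inj)

module _ {k : ℕ} where

  toℕ-next : (i : Fin (suc k)) → toℕ (next i) ≡ suc (toℕ i) % suc k
  toℕ-next i = toℕ-fromℕ< _

  toℕ-next-< : (i : Fin (suc k)) → toℕ i < k → toℕ (next i) ≡ suc (toℕ i)
  toℕ-next-< i i<k = trans (toℕ-next i) (m<n⇒m%n≡m (s≤s i<k))

  toℕ-next-last : (i : Fin (suc k)) → toℕ i ≡ k → toℕ (next i) ≡ 0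
  toℕ-next-last i i≡k = trans (toℕ-next i) (trans (cong (λ x → suc x % suc k) i≡k) (n%n≡0 (suc k)))

  below-or-last : (i : Fin (suc k)) → toℕ i < k ⊎ toℕ i ≡ k
  below-or-last i = m≤n⇒m<n∨m≡n (s≤s⁻¹ (toℕ<n i))

  next-injective : Injective _≡_ _≡_ (next {k})
  next-injective {i} {j} eq with below-or-last i | below-or-last j
  ... | inj₁ i<k | inj₁ j<k =
    toℕ-injective (suc-injective (trans (sym (toℕ-next-< i i<k)) (trans (cong toℕ eq) (toℕ-next-< j j<k))))
  ... | inj₂ i≡k | inj₂ j≡k = toℕ-injective (trans i≡k (sym j≡k))
  ... | inj₁ i<k | inj₂ j≡k
    with () ← trans (sym (toℕ-next-< i i<k)) (trans (cong toℕ eq) (toℕ-next-last j j≡k))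
  ... | inj₂ i≡k | inj₁ j<k
    with () ← trans (sym (toℕ-next-< j j<k)) (trans (cong toℕ (sym eq)) (toℕ-next-last i i≡k))

  next-last : next (fromℕ k) ≡ zero
  next-last = toℕ-injective (toℕ-next-last (fromℕ k) (toℕ-fromℕ k))

  next-surjective : ∀ (j : Fin (suc k)) → ∃[ i ] next i ≡ j
  next-surjective zero    = fromℕ k , next-last
  next-surjective (suc j) =
    inject₁ j , toℕ-injective (trans (toℕ-next-< (inject₁ j) j<k) (cong suc (toℕ-inject₁ j)))
    where j<k = subst (_< k) (sym (toℕ-inject₁ j)) (toℕ<n j)

  next-induction : (P : Fin (suc k) → Set) → (∀ i → P i → P (next i)) → ∀ {i} → P i → ∀ j → P j
  next-induction P closed {i} Pi j = climb (toℕ j) zero j refl P₀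
    where
    climb : ∀ d i j → toℕ i + d ≡ toℕ j → P i → P j
    climb zero    i j i+0≡j   Pi = subst P (toℕ-injective (trans (sym (+-identityʳ _)) i+0≡j)) Pi
    climb (suc d) i j i+1+d≡j Pi = climb d (next i) j i⁺+d≡j (closed i Pi)
      where
      i<k : toℕ i < k
      i<k = <-≤-trans (subst (toℕ i <_) i+1+d≡j (m<m+n (toℕ i) (s≤s z≤n))) (s≤s⁻¹ (toℕ<n j))
      i⁺+d≡j : toℕ (next i) + d ≡ toℕ j
      i⁺+d≡j = trans (cong (_+ d) (toℕ-next-< i i<k)) (trans (sym (+-suc (toℕ i) d)) i+1+d≡j)

    P₀ : P zero
    P₀ = subst P next-last (closed (fromℕ k) (climb (k ∸ toℕ i) i (fromℕ k) i+[k∸i]≡k Pi))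
      where i+[k∸i]≡k = trans (m+[n∸m]≡n (s≤s⁻¹ (toℕ<n i))) (sym (toℕ-fromℕ k))

next≢id : ∀ {k} (i : Fin (suc (suc k))) → next i ≢ i
next≢id i eq with below-or-last i
... | inj₁ i<k  = 1+n≢n (trans (sym (toℕ-next-< i i<k)) (cong toℕ eq))
... | inj₂ i≡k with () ← trans (sym i≡k) (trans (cong toℕ (sym eq)) (toℕ-next-last i i≡k))

Endpoint : (G : Multigraph) → Fin (nE G) → Fin (nV G) → Set
Endpoint G e x = src G e ≡ x ⊎ tgt G e ≡ x

module _ {G : Multigraph} where

  joins⇒endpointˡ : ∀ {e u w} → Joins G e u w → Endpoint G e u
  joins⇒endpointˡ (inj₁ (src≡u , _)) = inj₁ src≡u
  joins⇒endpointˡ (inj₂ (_ , tgt≡u)) = inj₂ tgt≡u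

  joins⇒endpointʳ : ∀ {e u w} → Joins G e u w → Endpoint G e w
  joins⇒endpointʳ (inj₁ (_ , tgt≡w)) = inj₂ tgt≡w
  joins⇒endpointʳ (inj₂ (src≡w , _)) = inj₁ src≡w

  endpoint-of-joins : ∀ {e u w x} → Joins G e u w → Endpoint G e x → x ≡ u ⊎ x ≡ w
  endpoint-of-joins (inj₁ (src≡u , _)) (inj₁ src≡x) = inj₁ (trans (sym src≡x) src≡u)
  endpoint-of-joins (inj₁ (_ , tgt≡w)) (inj₂ tgt≡x) = inj₂ (trans (sym tgt≡x) tgt≡w)
  endpoint-of-joins (inj₂ (src≡w , _)) (inj₁ src≡x) = inj₂ (trans (sym src≡x) src≡w)
  endpoint-of-joins (inj₂ (_ , tgt≡u)) (inj₂ tgt≡x) = inj₁ (trans (sym tgt≡x) tgt≡u)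

  endpoint-∈V : (X : Cycle G) → ∀ {e x} → e ∈E X → Endpoint G e x → x ∈V X
  endpoint-∈V X (r , refl) x∈e with endpoint-of-joins (joins X r) x∈e
  ... | inj₁ x≡vs = r , sym x≡vs
  ... | inj₂ x≡vs = next r , sym x≡vs

  -- Walking around X: the two edges of D at a vertex of X are distinct edges of X
  -- there, so one of them is the edge leaving that vertex forwards along X.
  edges⊆⇒vertices⊇ : (D X : Cycle G) → (∀ t → es D t ∈E X) → ∀ q → vs X q ∈V D
  edges⊆⇒vertices⊇ D X D⊆X = next-induction (λ q → vs X q ∈V D) forward (proj₂ start)
    where
    start : ∃[ q ] vs X q ∈V D
    start with endpoint-∈V X (D⊆X zero) (joins⇒endpointˡ (joins D zero))
    ... | q , vs≡ = q , zero , sym vs≡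

    position : ∀ {r q} → Endpoint G (es X r) (vs X q) → q ≡ r ⊎ q ≡ next r
    position {r} q∈r with endpoint-of-joins (joins X r) q∈r
    ... | inj₁ vs≡ = inj₁ (vs-inj X vs≡)
    ... | inj₂ vs≡ = inj₂ (vs-inj X vs≡)

    transport : ∀ {r s x q} → es X r ≡ es D s → Endpoint G (es D s) x → x ≡ vs X q →
                Endpoint G (es X r) (vs X q)
    transport r≡s x∈s x≡q = subst₂ (Endpoint G) (sym r≡s) x≡q x∈s

    along : ∀ {q s} → es X q ≡ es D s → vs X (next q) ∈V D
    along {q} {s} q≡s = endpoint-∈V D (s , sym q≡s) (joins⇒endpointʳ (joins X q))

    forward : ∀ q → vs X q ∈V D → vs X (next q) ∈V D
    forward q (u , u≡q) with next-surjective u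
    ... | t , refl with D⊆X t | D⊆X (next t)
    ... | r₁ , r₁≡t | r₂ , r₂≡t⁺
      with position (transport r₁≡t (joins⇒endpointʳ (joins D t)) u≡q)
         | position (transport r₂≡t⁺ (joins⇒endpointˡ (joins D (next t))) u≡q)
    ... | inj₁ refl   | _           = along r₁≡t
    ... | inj₂ _      | inj₁ refl   = along r₂≡t⁺
    ... | inj₂ q≡r₁⁺ | inj₂ q≡r₂⁺ =
      ⊥-elim (next≢id t (sym (es-inj D (trans (sym r₁≡t) (trans (cong (es X) r₁≡r₂) r₂≡t⁺)))))
      where r₁≡r₂ = next-injective (trans (sym q≡r₁⁺) q≡r₂⁺)

module _ {G : Multigraph} (𝒞 : CycleDecomposition G) where

  Shared : Fin (c 𝒞) → Fin (c 𝒞) → Fin (nV G) → Set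
  Shared i j v = v ∈V cyc 𝒞 i × v ∈V cyc 𝒞 j

  shared? : ∀ i j → Decidable (Shared i j)
  shared? i j v = any? (λ t → vs (cyc 𝒞 i) t ≟ v) ×-dec any? (λ t → vs (cyc 𝒞 j) t ≟ v)

  CImult-sym : ∀ i j → CImult 𝒞 i j ≡ CImult 𝒞 j i
  CImult-sym i j = cong length (filter-≐ (shared? i j) (shared? j i) (swap , swap) (allFin (nV G)))

  CImult≡0⇒disjoint : ∀ {i j v} → CImult 𝒞 i j ≡ 0 → v ∈V cyc 𝒞 i → ¬ v ∈V cyc 𝒞 j
  CImult≡0⇒disjoint {i} {j} {v} none v∈i v∈j =
    length-filter≡0⇒∄ (shared? i j) none (∈-allFin v) (v∈i , v∈j)

  CImult≡1⇒shared : ∀ {i j} → CImult 𝒞 i j ≡ 1 → ∃ (Shared i j)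
  CImult≡1⇒shared {i} {j} one = length-filter≡1⇒∃ (shared? i j) (allFin (nV G)) one

  CImult≡1⇒unique : ∀ {i j v w} → CImult 𝒞 i j ≡ 1 → Shared i j v → Shared i j w → v ≡ w
  CImult≡1⇒unique {i} {j} {v} {w} one =
    length-filter≡1⇒unique (shared? i j) one (∈-allFin v) (∈-allFin w)

module StarDecomposition
  (G : Multigraph) {m : ℕ} (C : Fin (suc (suc m)) → Cycle G)
  (covered : ∀ e → ∃[ a ] e ∈E C a)
  (z : Fin (suc (suc m)))
  (meets-centre : ∀ j → j ≢ z → ∃[ v ] (v ∈V C z × v ∈V C j))
  (meets-centre-once : ∀ j → j ≢ z → ∀ {v w} → v ∈V C z × v ∈V C j → w ∈V C z × w ∈V C j → v ≡ w)
  (leaves-disjoint : ∀ j k → j ≢ z → k ≢ z → j ≢ k → ∀ {v} → v ∈V C j → ¬ v ∈V C k)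
  where

  leaf : Fin (suc m) → Fin (suc (suc m))
  leaf = punchIn z

  leaf≢centre : ∀ k → leaf k ≢ z
  leaf≢centre = punchInᵢ≢i z

  ≢centre⇒leaf : ∀ {j} → j ≢ z → ∃[ k ] leaf k ≡ j
  ≢centre⇒leaf j≢z = punchOut (j≢z ∘ sym) , punchIn-punchOut (j≢z ∘ sym)

  attachment : Fin (suc m) → Fin (nV G)
  attachment k = proj₁ (meets-centre (leaf k) (leaf≢centre k))

  attachment-shared : ∀ k → attachment k ∈V C z × attachment k ∈V C (leaf k)
  attachment-shared k = proj₂ (meets-centre (leaf k) (leaf≢centre k))

  attachments : Subset (nV G)
  attachments = image attachment

  every-cycle-attached : ∀ a → ∃[ k ] attachment k ∈V C a
  every-cycle-attached a with a ≟ z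
  ... | yes refl = zero , proj₁ (attachment-shared zero)
  ... | no a≢z with ≢centre⇒leaf a≢z
  ... | k , refl = k , proj₂ (attachment-shared k)

  shared-with-centre⇒attachment : ∀ {b v} → b ≢ z → v ∈V C z → v ∈V C b → v ∈ attachments
  shared-with-centre⇒attachment b≢z v∈z v∈b with ≢centre⇒leaf b≢z
  ... | k , refl = subst (_∈ attachments) (sym v≡attachment) (∈-image attachment k)
    where v≡attachment = meets-centre-once (leaf k) (leaf≢centre k) (v∈z , v∈b) (attachment-shared k)

  shared⇒attachment : ∀ {a b v} → a ≢ b → v ∈V C a → v ∈V C b → v ∈ attachments
  shared⇒attachment {a} {b} a≢b v∈a v∈b with a ≟ z | b ≟ z
  ... | yes refl | yes refl = ⊥-elim (a≢b refl)
  ... | yes refl | no b≢z   = shared-with-centre⇒attachment b≢z v∈a v∈b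
  ... | no a≢z   | yes refl = shared-with-centre⇒attachment a≢z v∈b v∈a
  ... | no a≢z   | no b≢z   = ⊥-elim (leaves-disjoint a b a≢z b≢z a≢b v∈a v∈b)

  -- Consecutive edges of D share a vertex, which would be an attachment vertex
  -- if the edges lay in different cycles of the decomposition.
  avoiding⇒inside-one-cycle : (D : Cycle G) → (∀ t → vs D t ∉ attachments) →
                              ∃[ a ] (∀ t → es D t ∈E C a)
  avoiding⇒inside-one-cycle D avoids with covered (es D zero)
  ... | a , 0∈a = a , next-induction (λ t → es D t ∈E C a) stays 0∈a
    where
    stays : ∀ t → es D t ∈E C a → es D (next t) ∈E C a
    stays t t∈a with covered (es D (next t))
    ... | b , t⁺∈b with a ≟ b
    ... | yes refl = t⁺∈b
    ... | no a≢b   = ⊥-elim (avoids (next t) (shared⇒attachment a≢b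
                       (endpoint-∈V (C a) t∈a (joins⇒endpointʳ {G} (joins D t)))
                       (endpoint-∈V (C b) t⁺∈b (joins⇒endpointˡ {G} (joins D (next t))))))

  attachments-decycling : Decycling G attachments
  attachments-decycling D with any? (λ t → vs D t ∈? attachments)
  ... | yes hit = hit
  ... | no miss with avoiding⇒inside-one-cycle D (λ t t∈ → miss (t , t∈))
  ... | a , D⊆a with every-cycle-attached a
  ... | k , q , q≡k with edges⊆⇒vertices⊇ D (C a) D⊆a q
  ... | u , u≡q = ⊥-elim (miss (u , subst (_∈ attachments) (sym (trans u≡q q≡k)) (∈-image attachment k)))

  decycling⇒≥ : ∀ T → Decycling G T → suc m ≤ ∣ T ∣
  decycling⇒≥ T T-decycling =
    injection⇒≤∣∣ T hit hit-injective (λ k → proj₂ (T-decycling (C (leaf k))))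
    where
    hit : Fin (suc m) → Fin (nV G)
    hit k = vs (C (leaf k)) (proj₁ (T-decycling (C (leaf k))))
    hit-injective : Injective _≡_ _≡_ hit
    hit-injective {k} {k′} hit≡ with k ≟ k′
    ... | yes k≡k′ = k≡k′
    ... | no k≢k′  = ⊥-elim (leaves-disjoint (leaf k) (leaf k′) (leaf≢centre k) (leaf≢centre k′)
                       (k≢k′ ∘ punchIn-injective z k k′) (_ , refl) (_ , sym hit≡))

  decyclingNumber : DecyclingNumber G (suc m)
  decyclingNumber = (attachments , attachments-decycling , ∣attachments∣≡) , decycling⇒≥
    where ∣attachments∣≡ = ≤-antisym (∣image∣≤ attachment) (decycling⇒≥ attachments attachments-decycling)

theorem4 : (G : Multigraph) → Connected G → Even G →
    (𝒞 : CycleDecomposition G) → (n : ℕ) →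
    IsStar (c 𝒞) (CImult 𝒞) → CIedges 𝒞 ≡ n →
    DecyclingNumber G n
theorem4 G _ _ record { c = zero } n (() , _) _
theorem4 G _ _ record { c = suc zero } n (s≤s () , _) _
theorem4 G _ _ 𝒞@record { c = suc (suc _) } n star@(_ , z , spoke , no-edge) edges≡n =
  subst (DecyclingNumber G) (trans (sym (edgeCount-star (CImult-sym 𝒞) star)) edges≡n)
    (StarDecomposition.decyclingNumber G (cyc 𝒞) (covers 𝒞) z
      (λ j j≢z → CImult≡1⇒shared 𝒞 (spoke j j≢z))
      (λ j j≢z → CImult≡1⇒unique 𝒞 (spoke j j≢z))
      (λ j k j≢z k≢z j≢k → CImult≡0⇒disjoint 𝒞 (no-edge j k j≢z k≢z j≢k)))
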